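{- Let $G$ and $H$ be two non-trivial connected graphs of order $n_1$ and $n_2$, having $t_1$ and $t_2$ true twin equivalence classes, respectively. Then $\dim_l(G\boxtimes H)\ge n_1n_2-t_1t_2$.
   Context: Two vertices $u,v$ are true twins if $N_G[u]=N_G[v]$ (closed neighborhoods); the true twin equivalence classes are the classes of the relation $N_G[x]=N_G[y]$. A set $S$ is a local metric generator for a connected graph $G$ if for every two adjacent vertices $x,y$ there is $s\in S$ with $d_G(s,x)\ne d_G(s,y)$; $\dim_l(G)$ is the minimum cardinality of a local metric generator. The strong product $G\boxtimes H$ has vertex set $V(G)\times V(H)$, with $(a,b)\sim(c,d)$ iff ($a=c$ and $b\sim d$) or ($b=d$ and $a\sim c$) or ($a\sim c$ and $b\sim d$). -}

module Defs where

open import Data.Nat using (ℕ; zero; suc; _*_; _≤_)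
open import Data.Fin using (Fin; remQuot)
open import Data.Fin.Subset using (Subset; _∈_)
open import Data.Product using (_×_; _,_; proj₁; proj₂; ∃; ∃-syntax; Σ-syntax)
open import Data.Sum using (_⊎_; inj₁; inj₂)
open import Function.Bundles using (_⇔_)
open import Function.Definitions using (Surjective)
open import Relation.Binary.PropositionalEquality using (_≡_; refl; sym)
open import Relation.Nullary using (¬_)

record Graph (n : ℕ) : Set₁ where
  field
    Adj    : Fin n → Fin n → Set
    adjSym : ∀ {x y} → Adj x y → Adj y x
    irrefl : ∀ {x} → ¬ Adj x x
open Graph public

data Walk {n : ℕ} (G : Graph n) : Fin n → Fin n → ℕ → Set where
  here : ∀ {u} → Walk G u u zero
  step : ∀ {u w v k} → Adj G u w → Walk G w v k → Walk G u v (suc k)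

Dist : ∀ {n} (G : Graph n) → Fin n → Fin n → ℕ → Set
Dist G u v k = Walk G u v k × (∀ m → Walk G u v m → k ≤ m)

Connected : ∀ {n} → Graph n → Set
Connected {n} G = ∀ (u v : Fin n) → ∃[ k ] Walk G u v k

NonTrivial : ∀ {n} → Graph n → Set
NonTrivial {n} G = 2 ≤ n

InClosedNbhd : ∀ {n} (G : Graph n) → Fin n → Fin n → Set
InClosedNbhd G x z = (z ≡ x) ⊎ Adj G x z

TrueTwins : ∀ {n} (G : Graph n) → Fin n → Fin n → Set
TrueTwins {n} G x y = ∀ (z : Fin n) → InClosedNbhd G x z ⇔ InClosedNbhd G y z

-- G has exactly t true twin equivalence classes: there is a surjective
-- labelling of vertices by Fin t whose fibres are exactly the classes.
TwinClassCount : ∀ {n} (G : Graph n) → ℕ → Set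
TwinClassCount {n} G t =
  Σ[ c ∈ (Fin n → Fin t) ]
    (Surjective _≡_ _≡_ c × (∀ x y → (c x ≡ c y) ⇔ TrueTwins G x y))

LocalMetricGenerator : ∀ {n} (G : Graph n) → Subset n → Set
LocalMetricGenerator {n} G S =
  ∀ (x y : Fin n) → Adj G x y →
    ∃[ s ] (s ∈ S × ∃[ a ] ∃[ b ] (Dist G s x a × Dist G s y b × ¬ (a ≡ b)))

-- Strong product; vertex (a,b) is encoded as combine a b : Fin (n₁ * n₂),
-- decoded with remQuot.
SPAdj : ∀ {n₁ n₂} → Graph n₁ → Graph n₂ → Fin n₁ × Fin n₂ → Fin n₁ × Fin n₂ → Set
SPAdj G H (a , b) (c , d) =
  ((a ≡ c) × Adj H b d) ⊎ ((b ≡ d) × Adj G a c) ⊎ (Adj G a c × Adj H b d)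

private
  spSym : ∀ {n₁ n₂} (G : Graph n₁) (H : Graph n₂) {p q} → SPAdj G H p q → SPAdj G H q p
  spSym G H (inj₁ (e , h)) = inj₁ (sym e , adjSym H h)
  spSym G H (inj₂ (inj₁ (e , g))) = inj₂ (inj₁ (sym e , adjSym G g))
  spSym G H (inj₂ (inj₂ (g , h))) = inj₂ (inj₂ (adjSym G g , adjSym H h))

  spIrr : ∀ {n₁ n₂} (G : Graph n₁) (H : Graph n₂) {p} → ¬ SPAdj G H p p
  spIrr G H (inj₁ (_ , h)) = irrefl H h
  spIrr G H (inj₂ (inj₁ (_ , g))) = irrefl G g
  spIrr G H (inj₂ (inj₂ (g , _))) = irrefl G g

_⊠_ : ∀ {n₁ n₂} → Graph n₁ → Graph n₂ → Graph (n₁ * n₂)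
_⊠_ {n₁} {n₂} G H = record
  { Adj    = λ x y → SPAdj G H (remQuot n₂ x) (remQuot n₂ y)
  ; adjSym = spSym G H
  ; irrefl = spIrr G H
  }

-- Distinct true twins x, y are adjacent, and every other vertex s is at the
-- same distance from both: a shortest walk from s to x reaches x through a
-- neighbour of x, which is also y itself or a neighbour of y, and symmetrically.
-- So a local metric generator contains one of any two distinct true twins, i.e.
-- its complement meets each true twin class at most once, and a graph with t
-- true twin classes has dim_l ≥ n − t. Closed neighbourhoods in G ⊠ H are
-- products of closed neighbourhoods, so vertices whose coordinates are twins are
-- twins in G ⊠ H, and G ⊠ H has at most t₁ t₂ true twin classes.
module Submission where

open import Defs
open import Data.Nat using (ℕ; _*_; _∸_; _≤_; suc)
open import Data.Nat.Properties using (n≤1+n; ≤-refl; ≤-trans; ≤-antisym; ∸-monoʳ-≤; m∸[m∸n]≡n; module ≤-Reasoning)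
open import Data.Fin using (Fin; zero; suc; remQuot; combine)
open import Data.Fin.Properties using (_≟_; suc-injective; injective⇒≤; combine-injective; *↔×)
open import Data.Fin.Subset using (Subset; ∣_∣; inside; outside; _∈_; _∉_; ∁)
open import Data.Fin.Subset.Properties using (∣p∣≤n; ∣∁p∣≡n∸∣p∣; x∈∁p⇒x∉p)
open import Data.Vec.Base using (_∷_; here; there)
open import Data.Product using (_×_; _,_; proj₁; proj₂; ∃-syntax)
open import Data.Sum using (inj₁; inj₂)
open import Function.Bundles using (_⇔_; mk⇔; Equivalence; Injection)
open import Function.Definitions using (Injective)
open import Function.Properties.Inverse using (Inverse⇒Injection)
open import Relation.Binary.PropositionalEquality using (_≡_; _≢_; refl; sym; cong; cong₂; subst)
open import Relation.Nullary using (yes; no; contradiction)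

open Equivalence using (to; from)

enumerate : ∀ {n} (p : Subset n) → Fin ∣ p ∣ → Fin n
enumerate (outside ∷ p) i = suc (enumerate p i)
enumerate (inside ∷ p) zero = zero
enumerate (inside ∷ p) (suc i) = suc (enumerate p i)

enumerate-∈ : ∀ {n} (p : Subset n) i → enumerate p i ∈ p
enumerate-∈ (outside ∷ p) i = there (enumerate-∈ p i)
enumerate-∈ (inside ∷ p) zero = here
enumerate-∈ (inside ∷ p) (suc i) = there (enumerate-∈ p i)

enumerate-injective : ∀ {n} (p : Subset n) → Injective _≡_ _≡_ (enumerate p)
enumerate-injective (outside ∷ p) e = enumerate-injective p (suc-injective e)
enumerate-injective (inside ∷ p) {zero} {zero} e = refl
enumerate-injective (inside ∷ p) {suc i} {suc j} e =
  cong suc (enumerate-injective p (suc-injective e))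

injectiveOn⇒∣p∣≤ : ∀ {n m} (p : Subset n) (f : Fin n → Fin m) →
  (∀ {x y} → x ∈ p → y ∈ p → f x ≡ f y → x ≡ y) → ∣ p ∣ ≤ m
injectiveOn⇒∣p∣≤ p f inj =
  injective⇒≤ (λ e → enumerate-injective p (inj (enumerate-∈ p _) (enumerate-∈ p _) e))

remQuot-injective : ∀ {m} n → Injective _≡_ _≡_ (remQuot {m} n)
remQuot-injective {m} n = Injection.injective (Inverse⇒Injection (*↔× {m} {n}))

module _ {n : ℕ} (G : Graph n) where

  snoc : ∀ {u w v k} → Walk G u w k → Adj G w v → Walk G u v (suc k)
  snoc here e = step e here
  snoc (step e′ p) e = step e′ (snoc p e)

  unsnoc : ∀ {u v k} → Walk G u v (suc k) → ∃[ w ] (Walk G u w k × Adj G w v)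
  unsnoc (step e here) = _ , here , e
  unsnoc (step e (step e′ p)) with unsnoc (step e′ p)
  ... | w , q , a = w , step e q , a

  TrueTwins-sym : ∀ {x y} → TrueTwins G x y → TrueTwins G y x
  TrueTwins-sym tw z = mk⇔ (from (tw z)) (to (tw z))

  TrueTwins⇒Adj : ∀ {x y} → TrueTwins G x y → x ≢ y → Adj G x y
  TrueTwins⇒Adj {y = y} tw x≢y with from (tw y) (inj₁ refl)
  ... | inj₁ y≡x = contradiction (sym y≡x) x≢y
  ... | inj₂ adj = adj

  -- The last step of a walk to x starts in N[x] = N[y].
  walk-to-twin : ∀ {x y s k} → TrueTwins G x y → s ≢ x →
    Walk G s x k → ∃[ m ] (Walk G s y m × m ≤ k)
  walk-to-twin tw s≢x here = contradiction refl s≢x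
  walk-to-twin tw s≢x p@(step _ _) with unsnoc p
  ... | w , q , w~x with to (tw w) (inj₂ (adjSym G w~x))
  ... | inj₁ refl = _ , q , n≤1+n _
  ... | inj₂ y~w = _ , snoc q (adjSym G y~w) , ≤-refl

  TrueTwins⇒Dist≡ : ∀ {x y s a b} → TrueTwins G x y → s ≢ x → s ≢ y →
    Dist G s x a → Dist G s y b → a ≡ b
  TrueTwins⇒Dist≡ tw s≢x s≢y (pa , min-a) (pb , min-b)
    with walk-to-twin tw s≢x pa | walk-to-twin (TrueTwins-sym tw) s≢y pb
  ... | m , q , m≤a | m′ , q′ , m′≤b =
    ≤-antisym (≤-trans (min-a m′ q′) m′≤b) (≤-trans (min-b m q) m≤a)

  LocalMetricGenerator-separates-twins : ∀ {S x y} → LocalMetricGenerator G S →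
    x ∉ S → y ∉ S → TrueTwins G x y → x ≡ y
  LocalMetricGenerator-separates-twins {x = x} {y = y} gen x∉S y∉S tw with x ≟ y
  ... | yes x≡y = x≡y
  ... | no x≢y with gen x y (TrueTwins⇒Adj tw x≢y)
  ... | s , s∈S , a , b , dx , dy , a≢b =
    contradiction (TrueTwins⇒Dist≡ tw (λ { refl → x∉S s∈S }) (λ { refl → y∉S s∈S }) dx dy) a≢b

  LocalMetricGenerator⇒n∸t≤∣S∣ : ∀ {t S} (c : Fin n → Fin t) →
    (∀ x y → c x ≡ c y → TrueTwins G x y) →
    LocalMetricGenerator G S → n ∸ t ≤ ∣ S ∣
  LocalMetricGenerator⇒n∸t≤∣S∣ {t} {S} c c-twins gen = begin
    n ∸ t             ≤⟨ ∸-monoʳ-≤ n n∸∣S∣≤t ⟩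
    n ∸ (n ∸ ∣ S ∣)   ≡⟨ m∸[m∸n]≡n (∣p∣≤n S) ⟩
    ∣ S ∣             ∎
    where
    open ≤-Reasoning
    n∸∣S∣≤t : n ∸ ∣ S ∣ ≤ t
    n∸∣S∣≤t = subst (_≤ t) (∣∁p∣≡n∸∣p∣ S)
      (injectiveOn⇒∣p∣≤ (∁ S) c λ x∈∁S y∈∁S cx≡cy →
        LocalMetricGenerator-separates-twins gen (x∈∁p⇒x∉p x∈∁S) (x∈∁p⇒x∉p y∈∁S) (c-twins _ _ cx≡cy))

module _ {n₁ n₂ : ℕ} (G : Graph n₁) (H : Graph n₂) where

  π₁ : Fin (n₁ * n₂) → Fin n₁
  π₁ z = proj₁ (remQuot {n₁} n₂ z)

  π₂ : Fin (n₁ * n₂) → Fin n₂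
  π₂ z = proj₂ (remQuot {n₁} n₂ z)

  ⊠-closedNbhd : ∀ z w →
    InClosedNbhd (G ⊠ H) z w ⇔ (InClosedNbhd G (π₁ z) (π₁ w) × InClosedNbhd H (π₂ z) (π₂ w))
  ⊠-closedNbhd z w = mk⇔ split join
    where
    split : InClosedNbhd (G ⊠ H) z w → InClosedNbhd G (π₁ z) (π₁ w) × InClosedNbhd H (π₂ z) (π₂ w)
    split (inj₁ refl) = inj₁ refl , inj₁ refl
    split (inj₂ (inj₁ (e , h))) = inj₁ (sym e) , inj₂ h
    split (inj₂ (inj₂ (inj₁ (e , g)))) = inj₂ g , inj₁ (sym e)
    split (inj₂ (inj₂ (inj₂ (g , h)))) = inj₂ g , inj₂ h

    join : InClosedNbhd G (π₁ z) (π₁ w) × InClosedNbhd H (π₂ z) (π₂ w) → InClosedNbhd (G ⊠ H) z w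
    join (inj₁ e₁ , inj₁ e₂) = inj₁ (remQuot-injective n₂ (cong₂ _,_ e₁ e₂))
    join (inj₁ e₁ , inj₂ h) = inj₂ (inj₁ (sym e₁ , h))
    join (inj₂ g , inj₁ e₂) = inj₂ (inj₂ (inj₁ (sym e₂ , g)))
    join (inj₂ g , inj₂ h) = inj₂ (inj₂ (inj₂ (g , h)))

  ⊠-TrueTwins : ∀ {z z′} → TrueTwins G (π₁ z) (π₁ z′) → TrueTwins H (π₂ z) (π₂ z′) →
    TrueTwins (G ⊠ H) z z′
  ⊠-TrueTwins {z} {z′} tw₁ tw₂ w = mk⇔
    (λ z~w → let (g , h) = to (⊠-closedNbhd z w) z~w in
      from (⊠-closedNbhd z′ w) (to (tw₁ (π₁ w)) g , to (tw₂ (π₂ w)) h))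
    (λ z′~w → let (g , h) = to (⊠-closedNbhd z′ w) z′~w in
      from (⊠-closedNbhd z w) (from (tw₁ (π₁ w)) g , from (tw₂ (π₂ w)) h))

theorem10 : ∀ {n₁ n₂ t₁ t₂ : ℕ} (G : Graph n₁) (H : Graph n₂) →
    NonTrivial G → NonTrivial H → Connected G → Connected H →
    TwinClassCount G t₁ → TwinClassCount H t₂ →
    ∀ (S : Subset (n₁ * n₂)) → LocalMetricGenerator (G ⊠ H) S →
    n₁ * n₂ ∸ t₁ * t₂ ≤ ∣ S ∣
theorem10 {n₁} {n₂} {t₁} {t₂} G H _ _ _ _ (c₁ , _ , c₁-twins) (c₂ , _ , c₂-twins) S gen =
  LocalMetricGenerator⇒n∸t≤∣S∣ (G ⊠ H) c c-twins gen
  where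
  c : Fin (n₁ * n₂) → Fin (t₁ * t₂)
  c z = combine (c₁ (π₁ G H z)) (c₂ (π₂ G H z))

  c-twins : ∀ z z′ → c z ≡ c z′ → TrueTwins (G ⊠ H) z z′
  c-twins z z′ cz≡cz′ with combine-injective _ _ _ _ cz≡cz′
  ... | e₁ , e₂ = ⊠-TrueTwins G H (to (c₁-twins _ _) e₁) (to (c₂-twins _ _) e₂)
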